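{- Let $r\geq 3$, let $D$ be an $m$-colored semicomplete $r$-partite digraph and let $x,y\in V(D)$. If there exists a $k$-colored directed path from $x$ to $y$ for some $k\geq 4$, and there does not exist a $k'$-colored directed path from $y$ to $x$ with $k'\leq 4$, then $d(x,y)\leq 2$.
   Context: A digraph is $m$-colored if each arc is assigned one of $m$ colors. A semicomplete $r$-partite digraph is obtained from a complete $r$-partite graph by replacing each edge $uv$ by the arc $(u,v)$, the arc $(v,u)$, or both; no arcs join vertices of the same part. A directed path is $j$-colored if its arcs use exactly $j$ distinct colors. $d(x,y)$ denotes the minimum number of arcs of a directed path from $x$ to $y$. -}

module Defs where

open import Data.Nat using (ℕ; zero; suc; _≤_)
open import Data.Fin using (Fin; zero; suc; inject₁; fromℕ; _≟_)
open import Data.List using (List; map; length; deduplicate; allFin)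
open import Data.Product using (Σ; _×_; ∃)
open import Data.Sum using (_⊎_)
open import Relation.Binary.PropositionalEquality using (_≡_; _≢_)
open import Relation.Nullary using (¬_)
open import Function.Definitions using (Injective)

-- An m-colored digraph on the vertex set Fin n: an arc relation and a
-- colour (in Fin m) assigned to every ordered pair (only meaningful on arcs).
record ColoredDigraph (n m : ℕ) : Set₁ where
  field
    arc   : Fin n → Fin n → Set
    color : Fin n → Fin n → Fin m
open ColoredDigraph public

record SemicompleteMultipartite {n m : ℕ} (r : ℕ) (D : ColoredDigraph n m) : Set where
  field
    part         : Fin n → Fin r
    partNonempty : (i : Fin r) → ∃ λ v → part v ≡ i
    noArcInside  : (u v : Fin n) → part u ≡ part v → ¬ arc D u v
    semicomplete : (u v : Fin n) → part u ≢ part v → arc D u v ⊎ arc D v u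

record Path {n m : ℕ} (D : ColoredDigraph n m) (x y : Fin n) : Set where
  field
    len      : ℕ
    vtx      : Fin (suc len) → Fin n
    start    : vtx zero ≡ x
    end      : vtx (fromℕ len) ≡ y
    distinct : Injective _≡_ _≡_ vtx
    arcs     : (i : Fin len) → arc D (vtx (inject₁ i)) (vtx (suc i))
open Path public

arcColors : ∀ {n m} {D : ColoredDigraph n m} {x y : Fin n} → Path D x y → List (Fin m)
arcColors {D = D} P = map (λ i → color D (vtx P (inject₁ i)) (vtx P (suc i))) (allFin (len P))

numColors : ∀ {n m} {D : ColoredDigraph n m} {x y : Fin n} → Path D x y → ℕ
numColors P = length (deduplicate _≟_ (arcColors P))

IsColoredWith : ∀ {n m} {D : ColoredDigraph n m} {x y : Fin n} → Path D x y → ℕ → Set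
IsColoredWith P j = numColors P ≡ j

DistLe : ∀ {n m} (D : ColoredDigraph n m) (x y : Fin n) (k : ℕ) → Set
DistLe D x y k = Σ (Path D x y) λ P → len P ≤ k

module Submission where

-- A path uses at most as many colours as it has arcs, so the
-- hypothesis forbids every path from y back to x with at most four arcs.  If L ≤ 2, P itself is the shortcut.
-- If x and y lie in different parts, the arc between them must point from x
-- to y.  If they lie in the same part X, walk along P keeping the invariant
-- "y → wᵢ" for the current vertex wᵢ outside X.  The next vertex outside X
-- is w_t with t ≤ i + 2 (two consecutive vertices of P are never both in X).
-- Either x → w_t → y is the shortcut, or w_t → x closes the return path
-- y wᵢ … w_t x with at most four arcs, or y → w_t and the walk continues;
-- the walk ends at the latest at w_{L-1}, whose arc to y belongs to P.

open import Defs
open import Data.Nat using (ℕ; zero; suc; _+_; _∸_; _≤_; _<_; _≤?_; z≤n; s≤s)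
open import Data.Nat.Properties
  using (≤-trans; ≤-refl; ≤-reflexive; <-trans; <⇒≤; <⇒≢; ≰⇒>; n<1+n; m≤n+m; +-suc; +-comm; m∸n+n≡m)
open import Data.Fin using (Fin; zero; suc; inject₁; fromℕ; toℕ) renaming (_≟_ to _≟ᶠ_)
open import Data.List using (List; []; _∷_; _++_; map; length; lookup; allFin)
open import Data.List.Properties using (length-deduplicate; length-map; length-tabulate; length-++)
open import Data.List.Membership.Propositional.Properties using (∈-lookup)
open import Data.List.Relation.Unary.All as All using (All; []; _∷_)
import Data.List.Relation.Unary.All.Properties as All
open import Data.List.Relation.Unary.AllPairs as AllPairs using (AllPairs; []; _∷_)
import Data.List.Relation.Unary.AllPairs.Properties as AllPairs
open import Data.List.Relation.Unary.Linked using (Linked; []; [-]; _∷_)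
import Data.List.Relation.Unary.Linked.Properties as Linked
open import Data.Product using (Σ; _×_; _,_)
open import Data.Sum using (inj₁; inj₂)
open import Data.Empty using (⊥; ⊥-elim)
open import Relation.Nullary using (¬_; yes; no)
open import Relation.Binary.PropositionalEquality
  using (_≡_; _≢_; refl; sym; trans; cong; subst; subst₂; ≢-sym; module ≡-Reasoning)

numColors≤len : ∀ {n m} {D : ColoredDigraph n m} {x y : Fin n} (P : Path D x y) → numColors P ≤ len P
numColors≤len {m = m} {D = D} P = begin
  numColors P                   ≤⟨ length-deduplicate _≟ᶠ_ (arcColors P) ⟩
  length (arcColors P)          ≡⟨ length-map arcColor (allFin (len P)) ⟩
  length (allFin (len P))       ≡⟨ length-tabulate (λ i → i) ⟩
  len P                         ∎
  where
  open Data.Nat.Properties.≤-Reasoning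
  arcColor : Fin (len P) → Fin m
  arcColor i = color D (vtx P (inject₁ i)) (vtx P (suc i))

noShortReturn : ∀ {n m} {D : ColoredDigraph n m} {x y : Fin n} →
  ¬ (Σ ℕ λ k′ → k′ ≤ 4 × Σ (Path D y x) λ Q → IsColoredWith Q k′) → ¬ DistLe D y x 4
noShortReturn noQ (Q , short) = noQ (numColors Q , ≤-trans (numColors≤len Q) short , Q , refl)

0<+ : ∀ d {i} → 0 < i → 0 < d + i
0<+ d {i} 0<i = ≤-trans 0<i (m≤n+m i d)

final : {A : Set} → A → List A → A
final a []       = a
final _ (b ∷ vs) = final b vs

lookup-final : {A : Set} (a : A) (vs : List A) → lookup (a ∷ vs) (fromℕ (length vs)) ≡ final a vs
lookup-final a []       = refl
lookup-final a (b ∷ vs) = lookup-final b vs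

final-map : {A B : Set} (f : A → B) (a : A) (vs : List A) → final (f a) (map f vs) ≡ f (final a vs)
final-map f a []       = refl
final-map f a (b ∷ vs) = final-map f b vs

final-∷ʳ : {A : Set} (a : A) (vs : List A) (b : A) → final a (vs ++ b ∷ []) ≡ b
final-∷ʳ a []       b = refl
final-∷ʳ a (c ∷ vs) b = final-∷ʳ c vs b

lookup-injective : {A : Set} {xs : List A} → AllPairs _≢_ xs →
  {i j : Fin (length xs)} → lookup xs i ≡ lookup xs j → i ≡ j
lookup-injective (_ ∷ _)     {zero}  {zero}  _  = refl
lookup-injective (fresh ∷ _) {zero}  {suc j} eq = ⊥-elim (All.lookup fresh (∈-lookup j) eq)
lookup-injective (fresh ∷ _) {suc i} {zero}  eq = ⊥-elim (All.lookup fresh (∈-lookup i) (sym eq))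
lookup-injective (_ ∷ rest)  {suc i} {suc j} eq = cong suc (lookup-injective rest eq)

linked-lookup : {A : Set} {R : A → A → Set} {a : A} {vs : List A} → Linked R (a ∷ vs) →
  (i : Fin (length vs)) → R (lookup (a ∷ vs) (inject₁ i)) (lookup (a ∷ vs) (suc i))
linked-lookup (step ∷ _)     zero    = step
linked-lookup (_ ∷ steps)    (suc i) = linked-lookup steps i

pathAlong : ∀ {n m} (D : ColoredDigraph n m) (a b : Fin n) (vs : List (Fin n)) → final a vs ≡ b →
  AllPairs _≢_ (a ∷ vs) → Linked (arc D) (a ∷ vs) → Path D a b
pathAlong D a b vs ends fresh steps = record
  { len      = length vs
  ; vtx      = lookup (a ∷ vs)
  ; start    = refl
  ; end      = trans (lookup-final a vs) ends
  ; distinct = lookup-injective fresh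
  ; arcs     = linked-lookup steps
  }

-- clamp L j is the element j of Fin (suc L), saturated at L; it lets the
-- vertices of a path of length L be indexed by natural numbers.
clamp : (L j : ℕ) → Fin (suc L)
clamp L       zero    = zero
clamp zero    (suc j) = zero
clamp (suc L) (suc j) = suc (clamp L j)

toℕ-clamp : (L j : ℕ) → j ≤ L → toℕ (clamp L j) ≡ j
toℕ-clamp L       zero    _         = refl
toℕ-clamp (suc L) (suc j) (s≤s j≤L) = cong suc (toℕ-clamp L j j≤L)

clamp-top : (L : ℕ) → clamp L L ≡ fromℕ L
clamp-top zero    = refl
clamp-top (suc L) = cong suc (clamp-top L)

clamp-step : (L j : ℕ) → suc j ≤ L → Σ (Fin L) λ i → inject₁ i ≡ clamp L j × suc i ≡ clamp L (suc j)
clamp-step (suc L)       zero    _         = zero , refl , refl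
clamp-step (suc (suc L)) (suc j) (s≤s j<L) with clamp-step (suc L) j j<L
... | i , tail≡ , head≡ = suc i , cong suc tail≡ , cong suc head≡

-- run i d = i ∷ i+1 ∷ … ∷ d+i, the indices of a stretch of d arcs.
-- (Defined through after i d, the entries following i, so that run i d is
-- visibly a cons cell for every d.)
mutual
  run : ℕ → ℕ → List ℕ
  run i d = i ∷ after i d

  after : ℕ → ℕ → List ℕ
  after i zero    = []
  after i (suc d) = run (suc i) d

length-run : (i d : ℕ) → length (run i d) ≡ suc d
length-run i zero    = refl
length-run i (suc d) = cong suc (length-run (suc i) d)

module OnPath {n m : ℕ} {D : ColoredDigraph n m} {x y : Fin n} (P : Path D x y) where

  L : ℕ
  L = len P

  w : ℕ → Fin n
  w j = vtx P (clamp L j)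

  w-start : w 0 ≡ x
  w-start = start P

  w-end : w L ≡ y
  w-end = trans (cong (vtx P) (clamp-top L)) (end P)

  w-injective : ∀ {j l} → j ≤ L → l ≤ L → w j ≡ w l → j ≡ l
  w-injective {j} {l} j≤L l≤L eq =
    trans (sym (toℕ-clamp L j j≤L)) (trans (cong toℕ (distinct P eq)) (toℕ-clamp L l l≤L))

  w-arc : ∀ {j} → suc j ≤ L → arc D (w j) (w (suc j))
  w-arc {j} j<L with clamp-step L j j<L
  ... | i , tail≡ , head≡ = subst₂ (arc D) (cong (vtx P) tail≡) (cong (vtx P) head≡) (arcs P i)

  w-arc-last : ∀ {j} → suc j ≡ L → arc D (w j) (w L)
  w-arc-last {j} last = subst (λ t → arc D (w j) (w t)) last (w-arc (≤-reflexive last))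

  -- Indices s < t ≤ L name distinct vertices, so increasing index lists
  -- name duplicate-free vertex lists.
  Before : ℕ → ℕ → Set
  Before s t = s < t × t ≤ L

  before-trans : ∀ {s t u} → Before s t → Before t u → Before s u
  before-trans (s<t , _) (t<u , u≤L) = <-trans s<t t<u , u≤L

  Apart : ℕ → ℕ → Set
  Apart s t = w s ≢ w t

  before-apart : ∀ {s t} → Before s t → Apart s t
  before-apart (s<t , t≤L) eq = <⇒≢ s<t (w-injective (≤-trans (<⇒≤ s<t) t≤L) t≤L eq)

  sorted-apart : ∀ {is} → Linked Before is → AllPairs Apart is
  sorted-apart sorted = AllPairs.map before-apart (Linked.Linked⇒AllPairs before-trans sorted)

  indexPath : (s t : ℕ) (is : List ℕ) → final s is ≡ t → AllPairs Apart (s ∷ is) →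
    Linked (λ a b → arc D (w a) (w b)) (s ∷ is) → Path D (w s) (w t)
  indexPath s t is ends apart steps =
    pathAlong D (w s) (w t) (map w is) (trans (final-map w s is) (cong w ends))
      (AllPairs.map⁺ apart) (Linked.map⁺ steps)

  run-before : ∀ d i → d + i ≤ L → Linked Before (run i d)
  run-before zero    i _     = [-]
  run-before (suc d) i fits  =
    (n<1+n i , ≤-trans (s≤s (m≤n+m i d)) fits) ∷ run-before d (suc i) (subst (_≤ L) (sym (+-suc d i)) fits)

  run-interior : ∀ d i → 0 < i → d + i < L → All (λ t → 0 < t × t < L) (run i d)
  run-interior zero    i 0<i fits = (0<i , fits) ∷ []
  run-interior (suc d) i 0<i fits =
    (0<i , ≤-trans (s≤s (m≤n+m i d)) (<⇒≤ fits)) ∷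
    run-interior d (suc i) (s≤s z≤n) (subst (_< L) (sym (+-suc d i)) fits)

  run-steps : ∀ d i {s} → d + i < L → arc D (w s) (w i) → arc D (w (d + i)) (w 0) →
    Linked (λ a b → arc D (w a) (w b)) (s ∷ run i d ++ 0 ∷ [])
  run-steps zero    i fits enter leave = enter ∷ leave ∷ [-]
  run-steps (suc d) i fits enter leave =
    enter ∷ run-steps d (suc i) (subst (_< L) (sym (+-suc d i)) fits)
              (w-arc (≤-trans (s≤s (m≤n+m i d)) (<⇒≤ fits)))
              (subst (λ t → arc D (w t) (w 0)) (sym (+-suc d i)) leave)

  detour : ∀ d i → 0 < i → d + i < L → arc D (w L) (w i) → arc D (w (d + i)) (w 0) →
    DistLe D (w L) (w 0) (suc (suc d))
  detour d i 0<i fits enter leave = returnPath , ≤-reflexive returnLength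
    where
    returnPath : Path D (w L) (w 0)
    returnPath = indexPath L 0 (run i d ++ 0 ∷ []) (final-∷ʳ L (run i d) 0) (fromTop ∷ stretchThenStart)
      (run-steps d i fits enter leave)
      where
      -- The stretch avoids both endpoints of P, which differ from each other.
      interior : All (λ t → 0 < t × t < L) (run i d)
      interior = run-interior d i 0<i fits
      L≢0 : Apart L 0
      L≢0 = ≢-sym (before-apart (≤-trans (0<+ d 0<i) (<⇒≤ fits) , ≤-refl))
      fromTop : All (Apart L) (run i d ++ 0 ∷ [])
      fromTop = All.++⁺ (All.map (λ (_ , t<L) → ≢-sym (before-apart (t<L , ≤-refl))) interior) (L≢0 ∷ [])
      stretchThenStart : AllPairs Apart (run i d ++ 0 ∷ [])
      stretchThenStart = AllPairs.++⁺
        (sorted-apart (run-before d i (<⇒≤ fits))) ([] ∷ [])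
        (All.map (λ (0<t , t<L) → ≢-sym (before-apart (0<t , <⇒≤ t<L)) ∷ []) interior)
    returnLength : length (map w (run i d ++ 0 ∷ [])) ≡ suc (suc d)
    returnLength = begin
      length (map w (run i d ++ 0 ∷ []))  ≡⟨ length-map w (run i d ++ 0 ∷ []) ⟩
      length (run i d ++ 0 ∷ [])          ≡⟨ length-++ (run i d) ⟩
      length (run i d) + 1                ≡⟨ cong (_+ 1) (length-run i d) ⟩
      suc d + 1                           ≡⟨ cong suc (+-comm d 1) ⟩
      suc (suc d)                         ∎
      where open ≡-Reasoning

  via : ∀ t → 0 < t → t < L → arc D (w 0) (w t) → arc D (w t) (w L) → DistLe D (w 0) (w L) 2
  via t 0<t t<L into out =
    indexPath 0 L (t ∷ L ∷ []) refl (sorted-apart ((0<t , <⇒≤ t<L) ∷ (t<L , ≤-refl) ∷ [-]))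
      (into ∷ out ∷ [-])
    , ≤-refl

module Shortcut {r n m : ℕ} {D : ColoredDigraph n m} (S : SemicompleteMultipartite r D)
  {x y : Fin n} (P : Path D x y) (noReturn : ¬ DistLe D y x 4) where

  open SemicompleteMultipartite S
  open OnPath P

  noReturnᵂ : ¬ DistLe D (w L) (w 0) 4
  noReturnᵂ back = noReturn (subst₂ (λ a b → DistLe D a b 4) w-end w-start back)

  noDetour : ∀ d i → d ≤ 2 → 0 < i → d + i < L → arc D (w L) (w i) → arc D (w (d + i)) (w 0) → ⊥
  noDetour d i d≤2 0<i fits enter leave with detour d i 0<i fits enter leave
  ... | back , short = noReturnᵂ (back , ≤-trans short (s≤s (s≤s d≤2)))

  -- L = g + (t + 1) measures the remaining part of P after wₜ.
  gap< : ∀ g {t} → g + suc t ≡ L → t < L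
  gap< g {t} remaining = subst (suc t ≤_) remaining (m≤n+m (suc t) g)

  gap-step : ∀ g {t} → suc g + suc t ≡ L → g + suc (suc t) ≡ L
  gap-step g {t} remaining = trans (+-suc g (suc t)) remaining

  module SamePart (samePart : part (w 0) ≡ part (w L)) where

    Outside : ℕ → Set
    Outside t = part (w 0) ≢ part (w t)

    outside-y : ∀ {t} → Outside t → part (w t) ≢ part (w L)
    outside-y out inX = out (trans samePart (sym inX))

    leaves : ∀ {s t} → arc D (w s) (w t) → part (w s) ≡ part (w 0) → Outside t
    leaves step inX sameT = noArcInside _ _ (trans inX sameT) step

    entered : ∀ {t} → arc D (w L) (w t) → Outside t
    entered enter = leaves enter (sym samePart)

    mutual
      -- Invariant: y → wᵢ with 0 < i and L = g + (i + 1).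
      scan : ∀ g i → g + suc i ≡ L → 0 < i → arc D (w L) (w i) → DistLe D (w 0) (w L) 2
      scan zero i remaining 0<i enter with semicomplete (w 0) (w i) (entered enter)
      ... | inj₁ into = via i 0<i (gap< 0 remaining) into (w-arc-last remaining)
      ... | inj₂ leave = ⊥-elim (noDetour 0 i z≤n 0<i (gap< 0 remaining) enter leave)
      scan (suc g) i remaining 0<i enter with part (w 0) ≟ᶠ part (w (suc i))
      ... | no out = reach g 1 i (gap-step g remaining) (s≤s z≤n) 0<i enter out
      ... | yes inX = pastX g i remaining 0<i enter (sym inX)

      -- If wᵢ₊₁ lies in X, it is not the last vertex and wᵢ₊₂ lies outside X.
      pastX : ∀ g i → suc g + suc i ≡ L → 0 < i → arc D (w L) (w i) → part (w (suc i)) ≡ part (w 0) →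
        DistLe D (w 0) (w L) 2
      pastX zero    i remaining 0<i enter inX =
        ⊥-elim (noArcInside _ _ (trans inX samePart) (w-arc-last remaining))
      pastX (suc g) i remaining 0<i enter inX =
        reach g 2 i (gap-step g (gap-step (suc g) remaining)) ≤-refl 0<i enter
          (leaves (w-arc (gap< (suc g) (gap-step (suc g) remaining))) inX)

      -- The next vertex w_{d+i} outside X, d ≤ 2: it leads to x (impossible),
      -- or lies on a shortcut, or is entered from y and the walk continues.
      reach : ∀ g d i → g + suc (d + i) ≡ L → d ≤ 2 → 0 < i → arc D (w L) (w i) → Outside (d + i) →
        DistLe D (w 0) (w L) 2
      reach g d i remaining d≤2 0<i enter out with semicomplete (w 0) (w (d + i)) out
      ... | inj₂ leave = ⊥-elim (noDetour d i d≤2 0<i (gap< g remaining) enter leave)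
      ... | inj₁ into with semicomplete (w (d + i)) (w L) (outside-y out)
      ...   | inj₁ toY   = via (d + i) (0<+ d 0<i) (gap< g remaining) into toY
      ...   | inj₂ fromY = scan g (d + i) remaining (0<+ d 0<i) fromY

    -- w₁ is entered from x; it reaches y directly or the walk starts there.
    walk : 2 ≤ L → DistLe D (w 0) (w L) 2
    walk 2≤L with semicomplete (w 1) (w L) (outside-y (leaves {0} (w-arc (<⇒≤ 2≤L)) refl))
    ... | inj₁ toY   = via 1 (s≤s z≤n) 2≤L (w-arc (<⇒≤ 2≤L)) toY
    ... | inj₂ fromY = scan (L ∸ 2) 1 (m∸n+n≡m 2≤L) (s≤s z≤n) fromY

  acrossParts : Before 0 L → part (w 0) ≢ part (w L) → DistLe D (w 0) (w L) 2
  acrossParts 0<L differ with semicomplete (w 0) (w L) differ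
  ... | inj₁ forth = indexPath 0 L (L ∷ []) refl (sorted-apart (0<L ∷ [-])) (forth ∷ [-]) , s≤s z≤n
  ... | inj₂ back  = ⊥-elim (noReturnᵂ
        (indexPath L 0 (0 ∷ []) refl ((≢-sym (before-apart 0<L) ∷ []) ∷ [] ∷ []) (back ∷ [-]) , s≤s z≤n))

  longShortcut : 2 < L → DistLe D (w 0) (w L) 2
  longShortcut long with part (w 0) ≟ᶠ part (w L)
  ... | yes same   = SamePart.walk same (<⇒≤ long)
  ... | no  differ = acrossParts (≤-trans (s≤s z≤n) long , ≤-refl) differ

  shortcut : DistLe D x y 2
  shortcut with L ≤? 2
  ... | yes short = P , short
  ... | no long   = subst₂ (λ a b → DistLe D a b 2) w-start w-end (longShortcut (≰⇒> long))

mainTheorem5 : (r n m : ℕ) → 3 ≤ r → (D : ColoredDigraph n m) → SemicompleteMultipartite r D →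
    (x y : Fin n) →
    (Σ ℕ λ k → 4 ≤ k × Σ (Path D x y) λ P → IsColoredWith P k) →
    ¬ (Σ ℕ λ k′ → k′ ≤ 4 × Σ (Path D y x) λ Q → IsColoredWith Q k′) →
    DistLe D x y 2
mainTheorem5 _ _ _ _ D S x y (_ , _ , P , _) noShortColoured =
  Shortcut.shortcut S P (noShortReturn noShortColoured)
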